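{- Let $n\ge 1$ and let $L,\overline{L}$ be a diametral pair of linear extensions of the Boolean lattice $B_n$. Let $D\subseteq[n]$ with $d=|D|\ge 2$ and $I\subseteq[n]\setminus D$, and let $\mathcal{C}_{D,I}$ be the set of ordered pairs $(S,T)$ of subsets of $[n]$ with $S\triangle T=D$ and $S\cap T=I$. Then the number of unordered pairs $\{S,T\}$ with $(S,T)\in\mathcal{C}_{D,I}$ that appear in different orders in $L$ and $\overline{L}$ is exactly $2^{d-2}$.
   Context: $B_n$ is the poset of all subsets of $[n]$ ordered by inclusion. The distance between two linear extensions is the number of unordered pairs appearing in different orders in them; a diametral pair of linear extensions is a pair whose distance is maximum among all pairs of linear extensions. -}

module Defs where

open import Data.Nat using (ℕ; zero; suc; _<_; _≤_)
open import Data.Nat.Properties using (_<?_)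
open import Data.Bool using (Bool; true; false)
open import Data.Bool.Properties using () renaming (_≟_ to _≟ᵇ_)
open import Data.Vec using ([]; _∷_)
open import Data.Vec.Properties using (≡-dec)
open import Data.List using (List; []; _∷_; map; _++_; filter; length; cartesianProduct)
open import Data.Product using (_×_; _,_; proj₁; proj₂)
open import Data.Fin.Subset using (Subset; _⊂_; _∩_; _∪_; _─_)
open import Relation.Nullary using (Dec; _×-dec_)
open import Relation.Binary.PropositionalEquality using (_≡_)

_≟ₛ_ : ∀ {n} (S T : Subset n) → Dec (S ≡ T)
_≟ₛ_ = ≡-dec _≟ᵇ_

allSubsets : (n : ℕ) → List (Subset n)
allSubsets zero = [] ∷ []
allSubsets (suc n) = map (false ∷_) (allSubsets n) ++ map (true ∷_) (allSubsets n)

allPairs : (n : ℕ) → List (Subset n × Subset n)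
allPairs n = cartesianProduct (allSubsets n) (allSubsets n)

_△_ : ∀ {n} → Subset n → Subset n → Subset n
S △ T = (S ─ T) ∪ (T ─ S)

-- A linear extension of B_n: a total order on the subsets of [n], represented
-- by an injective ranking (S comes before T iff rank S < rank T) that is
-- strictly monotone w.r.t. strict inclusion.
record LinExt (n : ℕ) : Set where
  field
    rank      : Subset n → ℕ
    injective : ∀ S T → rank S ≡ rank T → S ≡ T
    monotone  : ∀ S T → S ⊂ T → rank S < rank T
open LinExt public

-- (S , T) is ordered S < T in L and T < S in M.  Every unordered pair {S,T}
-- appearing in different orders in L and M yields exactly one such ordered pair.
Discordant : ∀ {n} → LinExt n → LinExt n → Subset n × Subset n → Set
Discordant L M (S , T) = (rank L S < rank L T) × (rank M T < rank M S)

discordant? : ∀ {n} (L M : LinExt n) (p : Subset n × Subset n) → Dec (Discordant L M p)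
discordant? L M (S , T) = (rank L S <? rank L T) ×-dec (rank M T <? rank M S)

distance : ∀ {n} → LinExt n → LinExt n → ℕ
distance {n} L M = length (filter (discordant? L M) (allPairs n))

Diametral : ∀ {n} → LinExt n → LinExt n → Set
Diametral {n} L M = ∀ (L' M' : LinExt n) → distance L' M' ≤ distance L M

InCDisc : ∀ {n} → LinExt n → LinExt n → Subset n → Subset n → Subset n × Subset n → Set
InCDisc L M D I (S , T) = ((S △ T) ≡ D) × ((S ∩ T) ≡ I) × Discordant L M (S , T)

inCDisc? : ∀ {n} (L M : LinExt n) (D I : Subset n) (p : Subset n × Subset n) → Dec (InCDisc L M D I p)
inCDisc? L M D I (S , T) = ((S △ T) ≟ₛ D) ×-dec (((S ∩ T) ≟ₛ I) ×-dec discordant? L M (S , T))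

countCDisc : ∀ {n} → LinExt n → LinExt n → Subset n → Subset n → ℕ
countCDisc {n} L M D I = length (filter (inCDisc? L M D I) (allPairs n))

-- Group the pairs {S , T} by D = S △ T and I = S ∩ T. The class C_{D,I} consists of the pairs
-- {I ∪ A , I ∪ (D ─ A)} with A ⊆ D. For a linear extension L the sets A for which I ∪ A comes after
-- its partner form an up-set of subsets of D containing exactly one of A and D ─ A, so it has
-- 2^(d-1) members. The pairs of C_{D,I} ordered differently by L and M correspond to the sets in the
-- up-set of M but not in that of L; by the Harris–Kleitman inequality the two up-sets share at least
-- 2^(d-2) members, so at most 2^(d-2) pairs of C_{D,I} are discordant. The lex and colex orders
-- attain this bound in every class (for the A with min D ∉ A and max D ∈ A). Hence the distance of a
-- diametral pair is at least the sum of all class bounds, and as no class exceeds its bound, every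
-- class attains it.

module Submission where

open import Defs
open import Data.Bool using (Bool; true; false; _∧_; _∨_; not; T)
open import Data.Bool.Properties using (∧-zeroʳ; ∧-comm; T-∧)
open import Data.Empty using (⊥-elim)
open import Data.Fin using (zero; suc)
open import Data.Fin.Subset using (Subset; ⊥; _∩_; _∪_; _─_; ∣_∣; _⊆_; _⊂_; _∈_; _∉_; inside; outside)
open import Data.Fin.Subset.Properties
  using (drop-∷-⊆; drop-∷-⊂; drop-there; out⊆; s⊆s; s⊂s; out⊂in; ⊆-refl; x∈p∪q⁻; x∈p∪q⁺; x∈p∧x∉q⇒x∈p─q)
open import Data.List using (List; []; _∷_; map; _++_; filter; length; cartesianProduct)
open import Data.List.Membership.Propositional using () renaming (_∈_ to _∈ˡ_)
open import Data.List.Membership.Propositional.Properties using (∈-map⁺; ∈-++⁺ˡ; ∈-++⁺ʳ; ∈-cartesianProduct⁺)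
open import Data.List.Properties using (filter-none)
open import Data.List.Relation.Unary.All using () renaming (tabulate to allTabulate)
open import Data.List.Relation.Unary.Any using (here; there)
open import Data.Nat using (ℕ; zero; suc; _+_; _*_; _≤_; _<_; _<ᵇ_; _^_; _∸_; z≤n; s≤s; NonZero)
open import Data.Nat.Properties
open import Algebra.Properties.CommutativeSemigroup +-commutativeSemigroup
  using () renaming (interchange to +-interchange)
open import Data.Nat.Tactic.RingSolver using (solve-∀)
open import Data.Product using (_×_; _,_; proj₁; proj₂; uncurry)
open import Data.Sum using (_⊎_; inj₁; inj₂)
import Data.Sum as Sum
import Data.Product as Product
open import Data.Vec using ([]; _∷_; here; there)
open import Data.Vec.Properties using (∷-injectiveʳ)
open import Function using (_∘_; Equivalence)
open import Relation.Binary.Definitions using (tri<; tri≈; tri>)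
open import Relation.Binary.PropositionalEquality
open import Relation.Nullary using (yes; no; does; ¬_; contradiction)
open import Relation.Nullary.Decidable using (dec-true; dec-false)
open import Relation.Unary using (Decidable)

𝟙 : Bool → ℕ
𝟙 false = 0
𝟙 true  = 1

∑ : {A : Set} → List A → (A → ℕ) → ℕ
∑ []       f = 0
∑ (x ∷ xs) f = f x + ∑ xs f

module _ {A : Set} where

  length-filter≡∑ : {P : A → Set} (P? : Decidable P) (xs : List A) →
                    length (filter P? xs) ≡ ∑ xs (𝟙 ∘ does ∘ P?)
  length-filter≡∑ P? []       = refl
  length-filter≡∑ P? (x ∷ xs) with does (P? x)
  ... | false = length-filter≡∑ P? xs
  ... | true  = cong suc (length-filter≡∑ P? xs)

  ∑-cong : (xs : List A) {f g : A → ℕ} → (∀ x → f x ≡ g x) → ∑ xs f ≡ ∑ xs g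
  ∑-cong []       f≡g = refl
  ∑-cong (x ∷ xs) f≡g = cong₂ _+_ (f≡g x) (∑-cong xs f≡g)

  ∑-mono : (xs : List A) {f g : A → ℕ} → (∀ x → f x ≤ g x) → ∑ xs f ≤ ∑ xs g
  ∑-mono []       f≤g = z≤n
  ∑-mono (x ∷ xs) f≤g = +-mono-≤ (f≤g x) (∑-mono xs f≤g)

  ∑-zero : (xs : List A) {f : A → ℕ} → (∀ x → f x ≡ 0) → ∑ xs f ≡ 0
  ∑-zero xs f≡0 = trans (∑-cong xs f≡0) (∑-const0 xs)
    where
    ∑-const0 : (xs : List A) → ∑ xs (λ _ → 0) ≡ 0
    ∑-const0 []       = refl
    ∑-const0 (_ ∷ xs) = ∑-const0 xs

  ∑-++ : (xs ys : List A) (f : A → ℕ) → ∑ (xs ++ ys) f ≡ ∑ xs f + ∑ ys f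
  ∑-++ []       ys f = refl
  ∑-++ (x ∷ xs) ys f = trans (cong (f x +_) (∑-++ xs ys f)) (sym (+-assoc (f x) _ _))

  ∑-+ : (xs : List A) (f g : A → ℕ) → ∑ xs (λ x → f x + g x) ≡ ∑ xs f + ∑ xs g
  ∑-+ []       f g = refl
  ∑-+ (x ∷ xs) f g = trans (cong (f x + g x +_) (∑-+ xs f g))
                           (+-interchange (f x) (g x) (∑ xs f) (∑ xs g))

  ∑-≤-≡ : (xs : List A) {f g : A → ℕ} → (∀ x → f x ≤ g x) → ∑ xs g ≤ ∑ xs f →
          ∀ {x} → x ∈ˡ xs → f x ≡ g x
  ∑-≤-≡ (y ∷ ys) {f} {g} f≤g ∑g≤∑f (here refl) =
    ≤-antisym (f≤g y) (+-cancelʳ-≤ (∑ ys g) (g y) (f y)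
      (≤-trans ∑g≤∑f (+-monoʳ-≤ (f y) (∑-mono ys f≤g))))
  ∑-≤-≡ (y ∷ ys) {f} {g} f≤g ∑g≤∑f (there x∈ys) =
    ∑-≤-≡ ys f≤g (+-cancelˡ-≤ (g y) (∑ ys g) (∑ ys f)
      (≤-trans ∑g≤∑f (+-monoˡ-≤ (∑ ys f) (f≤g y)))) x∈ys

∑-map : {A B : Set} (g : A → B) (xs : List A) (f : B → ℕ) → ∑ (map g xs) f ≡ ∑ xs (f ∘ g)
∑-map g []       f = refl
∑-map g (x ∷ xs) f = cong (f (g x) +_) (∑-map g xs f)

∑-swap : {A B : Set} (xs : List A) (ys : List B) (h : A → B → ℕ) →
         ∑ xs (λ x → ∑ ys (h x)) ≡ ∑ ys (λ y → ∑ xs (λ x → h x y))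
∑-swap []       ys h = sym (∑-zero ys (λ _ → refl))
∑-swap (x ∷ xs) ys h =
  trans (cong (∑ ys (h x) +_) (∑-swap xs ys h)) (sym (∑-+ ys (h x) (λ y → ∑ xs (λ x' → h x' y))))

∑-cartesianProduct : {A B : Set} (xs : List A) (ys : List B) (f : A × B → ℕ) →
                     ∑ (cartesianProduct xs ys) f ≡ ∑ xs (λ x → ∑ ys (λ y → f (x , y)))
∑-cartesianProduct []       ys f = refl
∑-cartesianProduct (x ∷ xs) ys f =
  trans (∑-++ (map (x ,_) ys) _ f) (cong₂ _+_ (∑-map (x ,_) ys f) (∑-cartesianProduct xs ys f))

∈-allSubsets : ∀ {n} (S : Subset n) → S ∈ˡ allSubsets n
∈-allSubsets []                  = here refl
∈-allSubsets {suc n} (false ∷ S) = ∈-++⁺ˡ (∈-map⁺ (false ∷_) (∈-allSubsets S))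
∈-allSubsets {suc n} (true ∷ S)  =
  ∈-++⁺ʳ (map (false ∷_) (allSubsets n)) (∈-map⁺ (true ∷_) (∈-allSubsets S))

∑-allSubsets-suc : ∀ n (f : Subset (suc n) → ℕ) →
  ∑ (allSubsets (suc n)) f ≡ ∑ (allSubsets n) (f ∘ (false ∷_)) + ∑ (allSubsets n) (f ∘ (true ∷_))
∑-allSubsets-suc n f = trans (∑-++ (map (false ∷_) (allSubsets n)) _ f)
  (cong₂ _+_ (∑-map (false ∷_) (allSubsets n) f) (∑-map (true ∷_) (allSubsets n) f))

∑-select : ∀ {n} (a : Subset n) (b : Bool) → ∑ (allSubsets n) (λ D → 𝟙 (does (a ≟ₛ D) ∧ b)) ≡ 𝟙 b
∑-select []                  b = +-identityʳ (𝟙 b)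
∑-select {suc n} (false ∷ a) b = trans (∑-allSubsets-suc n _)
  (trans (cong₂ _+_ (∑-select a b) (∑-zero (allSubsets n) (λ _ → refl))) (+-identityʳ (𝟙 b)))
∑-select {suc n} (true ∷ a)  b = trans (∑-allSubsets-suc n _)
  (cong₂ _+_ (∑-zero (allSubsets n) (λ _ → refl)) (∑-select a b))

∑∑ : ∀ n → (Subset n → Subset n → ℕ) → ℕ
∑∑ n F = ∑ (allSubsets n) (λ S → ∑ (allSubsets n) (F S))

∑∑-zero : ∀ n {F : Subset n → Subset n → ℕ} → (∀ S T → F S T ≡ 0) → ∑∑ n F ≡ 0
∑∑-zero n F≡0 = ∑-zero (allSubsets n) (λ S → ∑-zero (allSubsets n) (F≡0 S))

∑∑-suc : ∀ n (F : Subset (suc n) → Subset (suc n) → ℕ) → ∑∑ (suc n) F ≡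
  (∑∑ n (λ S T → F (false ∷ S) (false ∷ T)) + ∑∑ n (λ S T → F (false ∷ S) (true ∷ T)))
  + (∑∑ n (λ S T → F (true ∷ S) (false ∷ T)) + ∑∑ n (λ S T → F (true ∷ S) (true ∷ T)))
∑∑-suc n F = trans (∑-allSubsets-suc n _) (cong₂ _+_ (split false) (split true))
  where
  split : ∀ b → ∑ (allSubsets n) (λ S → ∑ (allSubsets (suc n)) (F (b ∷ S)))
                ≡ ∑∑ n (λ S T → F (b ∷ S) (false ∷ T)) + ∑∑ n (λ S T → F (b ∷ S) (true ∷ T))
  split b = trans (∑-cong (allSubsets n) (λ S → ∑-allSubsets-suc n (F (b ∷ S)))) (∑-+ (allSubsets n) _ _)

-- Counting subsets; the Harris–Kleitman inequality

count⊆ : ∀ {n} → Subset n → (Subset n → Bool) → ℕ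
count⊆ []          f = 𝟙 (f [])
count⊆ (false ∷ D) f = count⊆ D (f ∘ (false ∷_))
count⊆ (true ∷ D)  f = count⊆ D (f ∘ (false ∷_)) + count⊆ D (f ∘ (true ∷_))

count⊆-cong : ∀ {n} (D : Subset n) {f g : Subset n → Bool} →
              (∀ A → A ⊆ D → f A ≡ g A) → count⊆ D f ≡ count⊆ D g
count⊆-cong []          f≡g = cong 𝟙 (f≡g [] ⊆-refl)
count⊆-cong (false ∷ D) f≡g = count⊆-cong D (λ A A⊆D → f≡g (false ∷ A) (out⊆ A⊆D))
count⊆-cong (true ∷ D)  f≡g = cong₂ _+_ (count⊆-cong D (λ A A⊆D → f≡g (false ∷ A) (out⊆ A⊆D)))
                                         (count⊆-cong D (λ A A⊆D → f≡g (true ∷ A) (s⊆s A⊆D)))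

𝟙-mono : ∀ a b → (T a → T b) → 𝟙 a ≤ 𝟙 b
𝟙-mono false b     _   = z≤n
𝟙-mono true  true  _   = ≤-refl
𝟙-mono true  false a⇒b = ⊥-elim (a⇒b _)

count⊆-mono : ∀ {n} (D : Subset n) {f g : Subset n → Bool} →
              (∀ A → A ⊆ D → T (f A) → T (g A)) → count⊆ D f ≤ count⊆ D g
count⊆-mono []          {f} {g} f⇒g = 𝟙-mono (f []) (g []) (f⇒g [] ⊆-refl)
count⊆-mono (false ∷ D) f⇒g = count⊆-mono D (λ A A⊆D → f⇒g (false ∷ A) (out⊆ A⊆D))
count⊆-mono (true ∷ D)  f⇒g = +-mono-≤ (count⊆-mono D (λ A A⊆D → f⇒g (false ∷ A) (out⊆ A⊆D)))
                                        (count⊆-mono D (λ A A⊆D → f⇒g (true ∷ A) (s⊆s A⊆D)))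

count⊆-split : ∀ {n} (D : Subset n) (f g : Subset n → Bool) →
               count⊆ D f ≡ count⊆ D (λ A → f A ∧ g A) + count⊆ D (λ A → f A ∧ not (g A))
count⊆-split []          f g = 𝟙-split (f []) (g [])
  where
  𝟙-split : ∀ a b → 𝟙 a ≡ 𝟙 (a ∧ b) + 𝟙 (a ∧ not b)
  𝟙-split false b     = refl
  𝟙-split true  false = refl
  𝟙-split true  true  = refl
count⊆-split (false ∷ D) f g = count⊆-split D _ _
count⊆-split (true ∷ D)  f g =
  trans (cong₂ _+_ (count⊆-split D (f ∘ (false ∷_)) (g ∘ (false ∷_)))
                   (count⊆-split D (f ∘ (true ∷_)) (g ∘ (true ∷_))))
        (+-interchange (count⊆ D (λ A → f (false ∷ A) ∧ g (false ∷ A))) _ _ _)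

count⊆-true : ∀ {n} (D : Subset n) → count⊆ D (λ _ → true) ≡ 2 ^ ∣ D ∣
count⊆-true []          = refl
count⊆-true (false ∷ D) = count⊆-true D
count⊆-true (true ∷ D)  = trans (cong₂ _+_ (count⊆-true D) (count⊆-true D))
                                (cong (2 ^ ∣ D ∣ +_) (sym (+-identityʳ _)))

count⊆-false : ∀ {n} (D : Subset n) → count⊆ D (λ _ → false) ≡ 0
count⊆-false []          = refl
count⊆-false (false ∷ D) = count⊆-false D
count⊆-false (true ∷ D)  = cong₂ _+_ (count⊆-false D) (count⊆-false D)

count⊆-complement : ∀ {n} (D : Subset n) (f : Subset n → Bool) → count⊆ D (f ∘ (D ─_)) ≡ count⊆ D f
count⊆-complement []          f = refl
count⊆-complement (false ∷ D) f = count⊆-complement D (f ∘ (false ∷_))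
count⊆-complement (true ∷ D)  f =
  trans (cong₂ _+_ (count⊆-complement D (f ∘ (true ∷_))) (count⊆-complement D (f ∘ (false ∷_))))
        (+-comm (count⊆ D (f ∘ (true ∷_))) _)

Monotone : ∀ {n} → (Subset n → Bool) → Set
Monotone f = ∀ {A B} → A ⊆ B → T (f A) → T (f B)

chebyshev : ∀ {a₀ a₁ b₀ b₁} → a₀ ≤ a₁ → b₀ ≤ b₁ → (a₀ + a₁) * (b₀ + b₁) ≤ 2 * (a₀ * b₀ + a₁ * b₁)
chebyshev {a₀} {b₀ = b₀} a₀≤a₁ b₀≤b₁ with m≤n⇒∃[o]m+o≡n a₀≤a₁ | m≤n⇒∃[o]m+o≡n b₀≤b₁
... | p , refl | q , refl =
  ≤-trans (m≤m+n _ (p * q)) (≤-reflexive (identity a₀ p b₀ q))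
  where
  identity : ∀ a p b q → (a + (a + p)) * (b + (b + q)) + p * q ≡ 2 * (a * b + (a + p) * (b + q))
  identity = solve-∀

Monotone-∷ : ∀ {n} {f : Subset (suc n) → Bool} b → Monotone f → Monotone (f ∘ (b ∷_))
Monotone-∷ b f↑ A⊆B = f↑ (s⊆s A⊆B)

harris-kleitman : ∀ {n} (D : Subset n) {f g : Subset n → Bool} → Monotone f → Monotone g →
                  count⊆ D f * count⊆ D g ≤ 2 ^ ∣ D ∣ * count⊆ D (λ A → f A ∧ g A)
harris-kleitman []          {f} {g} _ _ = 𝟙-∧ (f []) (g [])
  where
  𝟙-∧ : ∀ a b → 𝟙 a * 𝟙 b ≤ 1 * 𝟙 (a ∧ b)
  𝟙-∧ false b     = z≤n
  𝟙-∧ true  false = z≤n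
  𝟙-∧ true  true  = ≤-refl
harris-kleitman (false ∷ D) f↑ g↑ = harris-kleitman D (Monotone-∷ false f↑) (Monotone-∷ false g↑)
-- By monotonicity both families are larger on the half containing the new element, so Chebyshev's
-- inequality combines the two halves.
harris-kleitman (true ∷ D) {f} {g} f↑ g↑ = begin
  (a₀ + a₁) * (b₀ + b₁)                  ≤⟨ chebyshev (count⊆-mono D (λ _ _ → f↑ (out⊆ ⊆-refl)))
                                                      (count⊆-mono D (λ _ _ → g↑ (out⊆ ⊆-refl))) ⟩
  2 * (a₀ * b₀ + a₁ * b₁)                ≤⟨ *-monoʳ-≤ 2 (+-mono-≤ (ih false) (ih true)) ⟩
  2 * (2 ^ ∣ D ∣ * c₀ + 2 ^ ∣ D ∣ * c₁)  ≡⟨ cong (2 *_) (sym (*-distribˡ-+ (2 ^ ∣ D ∣) c₀ c₁)) ⟩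
  2 * (2 ^ ∣ D ∣ * (c₀ + c₁))            ≡⟨ sym (*-assoc 2 (2 ^ ∣ D ∣) _) ⟩
  2 ^ suc ∣ D ∣ * (c₀ + c₁)              ∎
  where
  open ≤-Reasoning
  a₀ = count⊆ D (f ∘ (false ∷_))
  a₁ = count⊆ D (f ∘ (true ∷_))
  b₀ = count⊆ D (g ∘ (false ∷_))
  b₁ = count⊆ D (g ∘ (true ∷_))
  c₀ = count⊆ D (λ A → f (false ∷ A) ∧ g (false ∷ A))
  c₁ = count⊆ D (λ A → f (true ∷ A) ∧ g (true ∷ A))
  ih : ∀ b → count⊆ D (f ∘ (b ∷_)) * count⊆ D (g ∘ (b ∷_)) ≤ 2 ^ ∣ D ∣ * count⊆ D (λ A → f (b ∷ A) ∧ g (b ∷ A))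
  ih b = harris-kleitman D (Monotone-∷ b f↑) (Monotone-∷ b g↑)

discordantᵇ : ∀ {n} → LinExt n → LinExt n → Subset n → Subset n → Bool
discordantᵇ L M S T = does (discordant? L M (S , T))

classIndicator : ∀ {n} → Subset n → Subset n → (Subset n → Subset n → Bool) → Subset n → Subset n → ℕ
classIndicator D I h S T = 𝟙 (does ((S △ T) ≟ₛ D) ∧ (does ((S ∩ T) ≟ₛ I) ∧ h S T))

countCDisc≡∑∑ : ∀ {n} (L M : LinExt n) (D I : Subset n) →
                countCDisc L M D I ≡ ∑∑ n (classIndicator D I (discordantᵇ L M))
countCDisc≡∑∑ {n} L M D I = trans (length-filter≡∑ (inCDisc? L M D I) (allPairs n))
                                   (∑-cartesianProduct (allSubsets n) (allSubsets n) _)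

distance≡∑countCDisc : ∀ {n} (L M : LinExt n) → distance L M ≡ ∑ (allPairs n) (uncurry (countCDisc L M))
distance≡∑countCDisc {n} L M = begin
  distance L M
    ≡⟨ length-filter≡∑ (discordant? L M) pairs ⟩
  ∑ pairs (𝟙 ∘ does ∘ discordant? L M)
    ≡⟨ ∑-cong pairs (sym ∘ ∑-classes) ⟩
  ∑ pairs (λ p → ∑ pairs (λ k → 𝟙 (does (inCDisc? L M (proj₁ k) (proj₂ k) p))))
    ≡⟨ ∑-swap pairs pairs _ ⟩
  ∑ pairs (λ k → ∑ pairs (𝟙 ∘ does ∘ inCDisc? L M (proj₁ k) (proj₂ k)))
    ≡⟨ ∑-cong pairs (λ k → sym (length-filter≡∑ (inCDisc? L M (proj₁ k) (proj₂ k)) pairs)) ⟩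
  ∑ pairs (uncurry (countCDisc L M))
    ∎
  where
  open ≡-Reasoning
  pairs = allPairs n
  subsets = allSubsets n

  ∧-swap : ∀ x y c → x ∧ (y ∧ c) ≡ y ∧ (x ∧ c)
  ∧-swap false false c = refl
  ∧-swap false true  c = refl
  ∧-swap true  y     c = refl

  -- each pair lies in exactly one class C_{D,I}
  ∑-classes : ∀ p → ∑ pairs (λ k → 𝟙 (does (inCDisc? L M (proj₁ k) (proj₂ k) p))) ≡ 𝟙 (does (discordant? L M p))
  ∑-classes (S , T) = begin
    ∑ pairs (λ k → 𝟙 (does (inCDisc? L M (proj₁ k) (proj₂ k) (S , T))))
      ≡⟨ ∑-cartesianProduct subsets subsets _ ⟩
    ∑ subsets (λ D → ∑ subsets (λ I → 𝟙 (does ((S △ T) ≟ₛ D) ∧ (does ((S ∩ T) ≟ₛ I) ∧ c))))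
      ≡⟨ ∑-cong subsets (λ D → trans (∑-cong subsets (λ I → cong 𝟙 (∧-swap (does ((S △ T) ≟ₛ D)) (does ((S ∩ T) ≟ₛ I)) c)))
                                       (∑-select (S ∩ T) (does ((S △ T) ≟ₛ D) ∧ c))) ⟩
    ∑ subsets (λ D → 𝟙 (does ((S △ T) ≟ₛ D) ∧ c))
      ≡⟨ ∑-select (S △ T) c ⟩
    𝟙 c ∎
    where c = discordantᵇ L M S T

∑∑-quadrants : ∀ n (F : Subset (suc n) → Subset (suc n) → ℕ) {a b c d} →
  ∑∑ n (λ S T → F (false ∷ S) (false ∷ T)) ≡ a → ∑∑ n (λ S T → F (false ∷ S) (true ∷ T)) ≡ b →
  ∑∑ n (λ S T → F (true ∷ S) (false ∷ T)) ≡ c → ∑∑ n (λ S T → F (true ∷ S) (true ∷ T)) ≡ d →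
  ∑∑ (suc n) F ≡ (a + b) + (c + d)
∑∑-quadrants n F ff ft tf tt = trans (∑∑-suc n F) (cong₂ _+_ (cong₂ _+_ ff ft) (cong₂ _+_ tf tt))

-- In each step only the
-- quadrants whose head bits fit D and I contribute; the others vanish because the head bit of
-- S △ T differs from that of D (definitionally) or the head bit of S ∩ T from that of I (∧-zeroʳ).
∑∑-class≡count⊆ : ∀ {n} (D I : Subset n) → I ∩ D ≡ ⊥ → (h : Subset n → Subset n → Bool) →
                  ∑∑ n (classIndicator D I h) ≡ count⊆ D (λ A → h (I ∪ A) (I ∪ (D ─ A)))
∑∑-class≡count⊆ {zero}  []          []          _     h = trans (+-identityʳ _) (+-identityʳ _)
∑∑-class≡count⊆ {suc n} (false ∷ D) (false ∷ I) I∩D≡⊥ h =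
  trans (∑∑-quadrants n _ (∑∑-class≡count⊆ D I (∷-injectiveʳ I∩D≡⊥) _)
                          (∑∑-zero n λ _ _ → refl)
                          (∑∑-zero n λ _ _ → refl)
                          (∑∑-zero n λ _ _ → cong 𝟙 (∧-zeroʳ _)))
        (trans (+-identityʳ _) (+-identityʳ _))
∑∑-class≡count⊆ {suc n} (false ∷ D) (true ∷ I)  I∩D≡⊥ h =
  ∑∑-quadrants n _ (∑∑-zero n λ _ _ → cong 𝟙 (∧-zeroʳ _))
                   (∑∑-zero n λ _ _ → refl)
                   (∑∑-zero n λ _ _ → refl)
                   (∑∑-class≡count⊆ D I (∷-injectiveʳ I∩D≡⊥) _)
∑∑-class≡count⊆ {suc n} (true ∷ D)  (false ∷ I) I∩D≡⊥ h =
  trans (∑∑-quadrants n _ (∑∑-zero n λ _ _ → refl)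
                          (∑∑-class≡count⊆ D I (∷-injectiveʳ I∩D≡⊥) (λ S T → h (false ∷ S) (true ∷ T)))
                          (∑∑-class≡count⊆ D I (∷-injectiveʳ I∩D≡⊥) (λ S T → h (true ∷ S) (false ∷ T)))
                          (∑∑-zero n λ _ _ → refl))
        (cong (count⊆ D (λ A → h (false ∷ (I ∪ A)) (true ∷ (I ∪ (D ─ A)))) +_) (+-identityʳ _))
∑∑-class≡count⊆ {suc n} (true ∷ D)  (true ∷ I)  ()    h

∩∩△≡⊥ : ∀ {n} (S T : Subset n) → (S ∩ T) ∩ (S △ T) ≡ ⊥
∩∩△≡⊥ []          []          = refl
∩∩△≡⊥ (false ∷ S) (t ∷ T)     = cong (false ∷_) (∩∩△≡⊥ S T)
∩∩△≡⊥ (true ∷ S)  (false ∷ T) = cong (false ∷_) (∩∩△≡⊥ S T)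
∩∩△≡⊥ (true ∷ S)  (true ∷ T)  = cong (false ∷_) (∩∩△≡⊥ S T)

countCDisc≡count⊆ : ∀ {n} (L M : LinExt n) (D I : Subset n) → I ∩ D ≡ ⊥ →
                    countCDisc L M D I ≡ count⊆ D (λ A → discordantᵇ L M (I ∪ A) (I ∪ (D ─ A)))
countCDisc≡count⊆ L M D I I∩D≡⊥ =
  trans (countCDisc≡∑∑ L M D I) (∑∑-class≡count⊆ D I I∩D≡⊥ (discordantᵇ L M))

countCDisc-overlapping : ∀ {n} (L M : LinExt n) (D I : Subset n) → ¬ (I ∩ D ≡ ⊥) → countCDisc L M D I ≡ 0
countCDisc-overlapping {n} L M D I I∩D≢⊥ =
  cong length (filter-none (inCDisc? L M D I) {allPairs n} (allTabulate λ { {S , T} _ (△≡D , ∩≡I , _) →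
    I∩D≢⊥ (subst₂ (λ I D → I ∩ D ≡ ⊥) ∩≡I △≡D (∩∩△≡⊥ S T)) }))

-- An upper bound for every pair of linear extensions

⊆⇒≡⊎⊂ : ∀ {n} {p q : Subset n} → p ⊆ q → p ≡ q ⊎ p ⊂ q
⊆⇒≡⊎⊂ {p = []}          {[]}          _   = inj₁ refl
⊆⇒≡⊎⊂ {p = outside ∷ p} {outside ∷ q} p⊆q = Sum.map (cong (outside ∷_)) s⊂s (⊆⇒≡⊎⊂ (drop-∷-⊆ p⊆q))
⊆⇒≡⊎⊂ {p = inside ∷ p}  {inside ∷ q}  p⊆q = Sum.map (cong (inside ∷_)) s⊂s (⊆⇒≡⊎⊂ (drop-∷-⊆ p⊆q))
⊆⇒≡⊎⊂ {p = outside ∷ p} {inside ∷ q}  p⊆q = inj₂ (out⊂in (drop-∷-⊆ p⊆q))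
⊆⇒≡⊎⊂ {p = inside ∷ p}  {outside ∷ q} p⊆q = contradiction (p⊆q here) λ ()

x∈p─q⁻ : ∀ {n} (p q : Subset n) {x} → x ∈ p ─ q → x ∈ p × x ∉ q
x∈p─q⁻ (inside ∷ p)  (outside ∷ q) here       = here , λ ()
x∈p─q⁻ (s ∷ p)       (t ∷ q)       (there x∈) = Product.map there (_∘ drop-there) (x∈p─q⁻ p q x∈)
x∈p─q⁻ (s ∷ p)       (inside ∷ q)  {zero} ()
x∈p─q⁻ (outside ∷ p) (outside ∷ q) {zero} ()

∪-monoʳ-⊆ : ∀ {n} (I : Subset n) {A B} → A ⊆ B → I ∪ A ⊆ I ∪ B
∪-monoʳ-⊆ I A⊆B x∈ = x∈p∪q⁺ (Sum.map₂ A⊆B (x∈p∪q⁻ I _ x∈))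

─-antitoneʳ-⊆ : ∀ {n} (D : Subset n) {A B} → A ⊆ B → D ─ B ⊆ D ─ A
─-antitoneʳ-⊆ D {B = B} A⊆B x∈ with x∈p─q⁻ D B x∈
... | x∈D , x∉B = x∈p∧x∉q⇒x∈p─q x∈D (x∉B ∘ A⊆B)

rank-mono : ∀ {n} (L : LinExt n) {A B} → A ⊆ B → rank L A ≤ rank L B
rank-mono L {A} {B} A⊆B = Sum.[ ≤-reflexive ∘ cong (rank L) , <⇒≤ ∘ monotone L A B ]′ (⊆⇒≡⊎⊂ A⊆B)

<ᵇ-flip : ∀ {x y} → x ≢ y → (x <ᵇ y) ≡ not (y <ᵇ x)
<ᵇ-flip {x} {y} x≢y with <-cmp x y
... | tri< x<y _ y≮x = trans (dec-true (x <? y) x<y) (cong not (sym (dec-false (y <? x) y≮x)))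
... | tri≈ _ x≡y _   = contradiction x≡y x≢y
... | tri> x≮y _ y<x = trans (dec-false (x <? y) x≮y) (cong not (sym (dec-true (y <? x) y<x)))

later : ∀ {n} → LinExt n → Subset n → Subset n → Subset n → Bool
later L D I A = rank L (I ∪ (D ─ A)) <ᵇ rank L (I ∪ A)

later-monotone : ∀ {n} (L : LinExt n) (D I : Subset n) → Monotone (later L D I)
later-monotone L D I {A} {B} A⊆B A-later = <⇒<ᵇ (begin-strict
  rank L (I ∪ (D ─ B)) ≤⟨ rank-mono L (∪-monoʳ-⊆ I (─-antitoneʳ-⊆ D A⊆B)) ⟩
  rank L (I ∪ (D ─ A)) <⟨ <ᵇ⇒< _ _ A-later ⟩
  rank L (I ∪ A)       ≤⟨ rank-mono L (∪-monoʳ-⊆ I A⊆B) ⟩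
  rank L (I ∪ B)       ∎)
  where open ≤-Reasoning

inside∷⊈outside∷ : ∀ {n} {A D : Subset n} {X : Set} → inside ∷ A ⊆ outside ∷ D → X
inside∷⊈outside∷ A⊆D = contradiction (A⊆D here) λ ()

p⊆q⇒q─[q─p]≡p : ∀ {n} (D A : Subset n) → A ⊆ D → D ─ (D ─ A) ≡ A
p⊆q⇒q─[q─p]≡p []          []          _   = refl
p⊆q⇒q─[q─p]≡p (false ∷ D) (false ∷ A) A⊆D = cong (false ∷_) (p⊆q⇒q─[q─p]≡p D A (drop-∷-⊆ A⊆D))
p⊆q⇒q─[q─p]≡p (false ∷ D) (true ∷ A)  A⊆D = inside∷⊈outside∷ A⊆D
p⊆q⇒q─[q─p]≡p (true ∷ D)  (false ∷ A) A⊆D = cong (false ∷_) (p⊆q⇒q─[q─p]≡p D A (drop-∷-⊆ A⊆D))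
p⊆q⇒q─[q─p]≡p (true ∷ D)  (true ∷ A)  A⊆D = cong (true ∷_) (p⊆q⇒q─[q─p]≡p D A (drop-∷-⊆ A⊆D))

I∪A≡I∪[D─A] : ∀ {n} (D I A : Subset n) → ∣ D ∣ ≡ 0 → A ⊆ D → I ∪ A ≡ I ∪ (D ─ A)
I∪A≡I∪[D─A] []          []      []          _      _   = refl
I∪A≡I∪[D─A] (false ∷ D) (i ∷ I) (false ∷ A) ∣D∣≡0 A⊆D = cong₂ _∷_ refl (I∪A≡I∪[D─A] D I A ∣D∣≡0 (drop-∷-⊆ A⊆D))
I∪A≡I∪[D─A] (false ∷ D) (i ∷ I) (true ∷ A)  ∣D∣≡0 A⊆D = inside∷⊈outside∷ A⊆D
I∪A≡I∪[D─A] (true ∷ D)  I       A           ()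

I∪A≢I∪[D─A] : ∀ {n k} (D I A : Subset n) → I ∩ D ≡ ⊥ → ∣ D ∣ ≡ suc k → A ⊆ D → I ∪ A ≢ I ∪ (D ─ A)
I∪A≢I∪[D─A] (false ∷ D) (i ∷ I)     (false ∷ A) I∩D≡⊥ ∣D∣≡ A⊆D =
  I∪A≢I∪[D─A] D I A (∷-injectiveʳ I∩D≡⊥) ∣D∣≡ (drop-∷-⊆ A⊆D) ∘ ∷-injectiveʳ
I∪A≢I∪[D─A] (false ∷ D) (i ∷ I)     (true ∷ A)  I∩D≡⊥ ∣D∣≡ A⊆D = inside∷⊈outside∷ A⊆D
I∪A≢I∪[D─A] (true ∷ D)  (false ∷ I) (false ∷ A) I∩D≡⊥ ∣D∣≡ A⊆D = λ ()
I∪A≢I∪[D─A] (true ∷ D)  (false ∷ I) (true ∷ A)  I∩D≡⊥ ∣D∣≡ A⊆D = λ ()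
I∪A≢I∪[D─A] (true ∷ D)  (true ∷ I)  A           ()

later-complement : ∀ {n k} (L : LinExt n) (D I : Subset n) → I ∩ D ≡ ⊥ → ∣ D ∣ ≡ suc k →
                   ∀ A → A ⊆ D → later L D I (D ─ A) ≡ not (later L D I A)
later-complement L D I I∩D≡⊥ ∣D∣≡ A A⊆D rewrite p⊆q⇒q─[q─p]≡p D A A⊆D =
  <ᵇ-flip (I∪A≢I∪[D─A] D I A I∩D≡⊥ ∣D∣≡ A⊆D ∘ injective L _ _)

count⊆-later : ∀ {n k} (L : LinExt n) (D I : Subset n) → I ∩ D ≡ ⊥ → ∣ D ∣ ≡ suc k →
              count⊆ D (later L D I) ≡ 2 ^ k
count⊆-later {k = k} L D I I∩D≡⊥ ∣D∣≡ = *-cancelˡ-≡ _ _ 2 (begin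
  2 * c                                           ≡⟨ cong (c +_) (+-identityʳ c) ⟩
  c + c                                           ≡⟨ cong (c +_) (sym (count⊆-complement D (later L D I))) ⟩
  c + count⊆ D (later L D I ∘ (D ─_))             ≡⟨ cong (c +_) (count⊆-cong D (later-complement L D I I∩D≡⊥ ∣D∣≡)) ⟩
  c + count⊆ D (not ∘ later L D I)                ≡⟨ sym (count⊆-split D (λ _ → true) (later L D I)) ⟩
  count⊆ D (λ _ → true)                           ≡⟨ count⊆-true D ⟩
  2 ^ ∣ D ∣                                       ≡⟨ cong (2 ^_) ∣D∣≡ ⟩
  2 * 2 ^ k                                       ∎)
  where
  open ≡-Reasoning
  c = count⊆ D (later L D I)

discordantᵇ-classPair : ∀ {n k} (L M : LinExt n) (D I : Subset n) → I ∩ D ≡ ⊥ → ∣ D ∣ ≡ suc k →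
  ∀ A → A ⊆ D → discordantᵇ L M (I ∪ A) (I ∪ (D ─ A)) ≡ later M D I A ∧ not (later L D I A)
discordantᵇ-classPair L M D I I∩D≡⊥ ∣D∣≡ A A⊆D =
  trans (cong (_∧ later M D I A) (<ᵇ-flip (I∪A≢I∪[D─A] D I A I∩D≡⊥ ∣D∣≡ A⊆D ∘ injective L _ _)))
        (∧-comm (not (later L D I A)) (later M D I A))

countCDisc≡count⊆-later : ∀ {n k} (L M : LinExt n) (D I : Subset n) → I ∩ D ≡ ⊥ → ∣ D ∣ ≡ suc k →
  countCDisc L M D I ≡ count⊆ D (λ A → later M D I A ∧ not (later L D I A))
countCDisc≡count⊆-later L M D I I∩D≡⊥ ∣D∣≡ =
  trans (countCDisc≡count⊆ L M D I I∩D≡⊥) (count⊆-cong D (discordantᵇ-classPair L M D I I∩D≡⊥ ∣D∣≡))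

-- For D = ∅ the class C_{D,I} consists of the single pair (I , I), which cannot be discordant.
countCDisc-degenerate : ∀ {n} (L M : LinExt n) (D I : Subset n) → I ∩ D ≡ ⊥ → ∣ D ∣ ≡ 0 →
                        countCDisc L M D I ≡ 0
countCDisc-degenerate L M D I I∩D≡⊥ ∣D∣≡0 =
  trans (countCDisc≡count⊆ L M D I I∩D≡⊥) (trans (count⊆-cong D not-discordant) (count⊆-false D))
  where
  not-discordant : ∀ A → A ⊆ D → discordantᵇ L M (I ∪ A) (I ∪ (D ─ A)) ≡ false
  not-discordant A A⊆D rewrite sym (I∪A≡I∪[D─A] D I A ∣D∣≡0 A⊆D) =
    dec-false (discordant? L M _) (λ (S<S , _) → <-irrefl refl S<S)

maxDiscordant : ℕ → ℕ
maxDiscordant 0             = 0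
maxDiscordant 1             = 0
maxDiscordant (suc (suc k)) = 2 ^ k

-- The correlation bound forces x ≥ 2ᵏ⁻¹, hence y = 2ᵏ − x ≤ 2ᵏ⁻¹ (and y = 0 when k = 0).
harris-bound : ∀ k x y → 2 ^ k * 2 ^ k ≤ 2 ^ suc k * x → 2 ^ k ≡ x + y → y ≤ maxDiscordant (suc k)
harris-bound k x y correlated 2ᵏ≡x+y = half-bound k (+-cancelʳ-≤ (2 ^ k) (2 * y) (2 ^ k) (begin
  2 * y + 2 ^ k     ≤⟨ +-monoʳ-≤ (2 * y) 2ᵏ≤2x ⟩
  2 * y + 2 * x     ≡⟨ trans (sym (*-distribˡ-+ 2 y x)) (cong (2 *_) (+-comm y x)) ⟩
  2 * (x + y)       ≡⟨ cong (2 *_) (sym 2ᵏ≡x+y) ⟩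
  2 * 2 ^ k         ≡⟨ cong (2 ^ k +_) (+-identityʳ (2 ^ k)) ⟩
  2 ^ k + 2 ^ k     ∎))
  where
  open ≤-Reasoning
  instance
    2ᵏ≢0 : NonZero (2 ^ k)
    2ᵏ≢0 = m^n≢0 2 k
  2ᵏ≤2x : 2 ^ k ≤ 2 * x
  2ᵏ≤2x = *-cancelˡ-≤ (2 ^ k) (≤-trans correlated (≤-reflexive (reassoc (2 ^ k) x)))
    where
    reassoc : ∀ a x → (2 * a) * x ≡ a * (2 * x)
    reassoc = solve-∀
  half-bound : ∀ k {y} → 2 * y ≤ 2 ^ k → y ≤ maxDiscordant (suc k)
  half-bound zero    {zero}  _         = z≤n
  half-bound zero    {suc y} (s≤s 2y+1≤0) = contradiction (≤-trans (m≤n+m (suc (y + 0)) y) 2y+1≤0) λ ()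
  half-bound (suc k)         2y≤2ᵏ⁺¹   = *-cancelˡ-≤ 2 2y≤2ᵏ⁺¹

countCDisc≤maxDiscordant : ∀ {n} (L M : LinExt n) (D I : Subset n) → I ∩ D ≡ ⊥ →
                           countCDisc L M D I ≤ maxDiscordant ∣ D ∣
countCDisc≤maxDiscordant L M D I I∩D≡⊥ with ∣ D ∣ in ∣D∣≡
... | zero  = ≤-reflexive (countCDisc-degenerate L M D I I∩D≡⊥ ∣D∣≡)
... | suc k = subst (_≤ maxDiscordant (suc k)) (sym (countCDisc≡count⊆-later L M D I I∩D≡⊥ ∣D∣≡))
                    (harris-bound k x y correlated (trans (sym (count⊆-later M D I I∩D≡⊥ ∣D∣≡))
                                                          (count⊆-split D _ _)))
  where
  x = count⊆ D (λ A → later M D I A ∧ later L D I A)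
  y = count⊆ D (λ A → later M D I A ∧ not (later L D I A))
  correlated : 2 ^ k * 2 ^ k ≤ 2 ^ suc k * x
  correlated = subst₂ (λ a b → a * b ≤ 2 ^ suc k * x)
                      (count⊆-later M D I I∩D≡⊥ ∣D∣≡) (count⊆-later L D I I∩D≡⊥ ∣D∣≡)
                      (subst (λ d → count⊆ D (later M D I) * count⊆ D (later L D I) ≤ 2 ^ d * x) ∣D∣≡
                             (harris-kleitman D (later-monotone M D I) (later-monotone L D I)))

-- The lex/colex pair attains the bound

-- The binary value of the characteristic vector, with the first coordinate the most (lex) or the
-- least (colex) significant bit: ties between two sets are broken by their first, resp. last,
-- difference.
lexRank : ∀ {n} → Subset n → ℕ
lexRank []              = 0
lexRank {suc n} (s ∷ S) = 𝟙 s * 2 ^ n + lexRank S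

colexRank : ∀ {n} → Subset n → ℕ
colexRank []      = 0
colexRank (s ∷ S) = 𝟙 s + 2 * colexRank S

lexRank<2ⁿ : ∀ {n} (S : Subset n) → lexRank S < 2 ^ n
lexRank<2ⁿ []              = s≤s z≤n
lexRank<2ⁿ {suc n} (s ∷ S) = begin-strict
  𝟙 s * 2 ^ n + lexRank S  <⟨ +-mono-≤-< (𝟙*≤ s) (lexRank<2ⁿ S) ⟩
  2 ^ n + 2 ^ n            ≡⟨ cong (2 ^ n +_) (sym (+-identityʳ _)) ⟩
  2 ^ suc n                ∎
  where
  open ≤-Reasoning
  𝟙*≤ : ∀ s → 𝟙 s * 2 ^ n ≤ 2 ^ n
  𝟙*≤ false = z≤n
  𝟙*≤ true  = ≤-reflexive (+-identityʳ (2 ^ n))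

lexRank-outside<inside : ∀ {n} (S T : Subset n) → lexRank (outside ∷ S) < lexRank (inside ∷ T)
lexRank-outside<inside {n} S T =
  ≤-trans (lexRank<2ⁿ S) (≤-trans (≤-reflexive (sym (+-identityʳ _))) (m≤m+n _ (lexRank T)))

lexRank-injective : ∀ {n} (S T : Subset n) → lexRank S ≡ lexRank T → S ≡ T
lexRank-injective []            []            _ = refl
lexRank-injective (outside ∷ S) (outside ∷ T) e = cong (outside ∷_) (lexRank-injective S T e)
lexRank-injective {suc n} (inside ∷ S) (inside ∷ T) e =
  cong (inside ∷_) (lexRank-injective S T (+-cancelˡ-≡ (2 ^ n + 0) _ _ e))
lexRank-injective (outside ∷ S) (inside ∷ T)  e = contradiction e (<⇒≢ (lexRank-outside<inside S T))
lexRank-injective (inside ∷ S)  (outside ∷ T) e = contradiction (sym e) (<⇒≢ (lexRank-outside<inside T S))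

lexRank-mono : ∀ {n} {S T : Subset n} → S ⊂ T → lexRank S < lexRank T
lexRank-mono {S = []}          {[]}          (_ , () , _)
lexRank-mono {S = outside ∷ S} {outside ∷ T} S⊂T = lexRank-mono (drop-∷-⊂ S⊂T)
lexRank-mono {suc n} {inside ∷ S} {inside ∷ T} S⊂T = +-monoʳ-< (2 ^ n + 0) (lexRank-mono (drop-∷-⊂ S⊂T))
lexRank-mono {S = outside ∷ S} {inside ∷ T}  _         = lexRank-outside<inside S T
lexRank-mono {S = inside ∷ S}  {outside ∷ T} (S⊆T , _) = inside∷⊈outside∷ S⊆T

colex-step : ∀ s t {x y} → x < y → 𝟙 s + 2 * x < 𝟙 t + 2 * y
colex-step s t {x} {y} x<y = begin-strict
  𝟙 s + 2 * x  ≤⟨ +-monoˡ-≤ (2 * x) (𝟙≤1 s) ⟩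
  1 + 2 * x    <⟨ n<1+n _ ⟩
  2 + 2 * x    ≡⟨ sym (*-suc 2 x) ⟩
  2 * suc x    ≤⟨ *-monoʳ-≤ 2 x<y ⟩
  2 * y        ≤⟨ m≤n+m (2 * y) (𝟙 t) ⟩
  𝟙 t + 2 * y  ∎
  where
  open ≤-Reasoning
  𝟙≤1 : ∀ s → 𝟙 s ≤ 1
  𝟙≤1 false = z≤n
  𝟙≤1 true  = ≤-refl

colexRank-injective : ∀ {n} (S T : Subset n) → colexRank S ≡ colexRank T → S ≡ T
colexRank-injective []            []            _ = refl
colexRank-injective (outside ∷ S) (outside ∷ T) e =
  cong (outside ∷_) (colexRank-injective S T (*-cancelˡ-≡ _ _ 2 e))
colexRank-injective (inside ∷ S)  (inside ∷ T)  e =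
  cong (inside ∷_) (colexRank-injective S T (*-cancelˡ-≡ _ _ 2 (suc-injective e)))
colexRank-injective (outside ∷ S) (inside ∷ T)  e = contradiction e (even≢odd (colexRank S) (colexRank T))
colexRank-injective (inside ∷ S)  (outside ∷ T) e = contradiction (sym e) (even≢odd (colexRank T) (colexRank S))

colexRank-mono : ∀ {n} {S T : Subset n} → S ⊂ T → colexRank S < colexRank T
colexRank-mono {S = []}          {[]}          (_ , () , _)
colexRank-mono {S = outside ∷ S} {outside ∷ T} S⊂T = colex-step outside outside (colexRank-mono (drop-∷-⊂ S⊂T))
colexRank-mono {S = inside ∷ S}  {inside ∷ T}  S⊂T = colex-step inside inside (colexRank-mono (drop-∷-⊂ S⊂T))
colexRank-mono {S = outside ∷ S} {inside ∷ T}  (S⊆T , _) with ⊆⇒≡⊎⊂ (drop-∷-⊆ S⊆T)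
... | inj₁ refl = n<1+n _
... | inj₂ S⊂T  = colex-step outside inside (colexRank-mono S⊂T)
colexRank-mono {S = inside ∷ S}  {outside ∷ T} (S⊆T , _) = inside∷⊈outside∷ S⊆T

lex : ∀ {n} → LinExt n
lex = record { rank = lexRank ; injective = lexRank-injective ; monotone = λ _ _ → lexRank-mono }

colex : ∀ {n} → LinExt n
colex = record { rank = colexRank ; injective = colexRank-injective ; monotone = λ _ _ → colexRank-mono }

-- The lex order separates the pair of A at min D, the colex order at max D.
minOutside : ∀ {n} → Subset n → Subset n → Bool
minOutside []          []      = false
minOutside (false ∷ D) (_ ∷ A) = minOutside D A
minOutside (true ∷ D)  (a ∷ A) = not a

maxInside : ∀ {n} → Subset n → Subset n → Bool
maxInside []          []      = false
maxInside (false ∷ D) (_ ∷ A) = maxInside D A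
maxInside (true ∷ D)  (a ∷ A) with ∣ D ∣
... | zero  = a
... | suc _ = maxInside D A

lex-earlier : ∀ {n} (D I A : Subset n) → I ∩ D ≡ ⊥ → A ⊆ D → T (minOutside D A) →
              lexRank (I ∪ A) < lexRank (I ∪ (D ─ A))
lex-earlier []          []          []          _ _   ()
lex-earlier {suc m} (false ∷ D) (i ∷ I) (false ∷ A) I∩D≡⊥ A⊆D min∉A =
  +-monoʳ-< (𝟙 (i ∨ false) * 2 ^ m) (lex-earlier D I A (∷-injectiveʳ I∩D≡⊥) (drop-∷-⊆ A⊆D) min∉A)
lex-earlier (false ∷ D) I           (true ∷ A)  _ A⊆D _ = inside∷⊈outside∷ A⊆D
lex-earlier (true ∷ D)  (false ∷ I) (false ∷ A) _ _   _ = lexRank-outside<inside (I ∪ A) (I ∪ (D ─ A))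
lex-earlier (true ∷ D)  (false ∷ I) (true ∷ A)  _ _   ()
lex-earlier (true ∷ D)  (true ∷ I)  A           ()

colex-later : ∀ {n} (D I A : Subset n) → I ∩ D ≡ ⊥ → A ⊆ D → T (maxInside D A) →
                colexRank (I ∪ (D ─ A)) < colexRank (I ∪ A)
colex-later []          []          []          _ _   ()
colex-later (false ∷ D) (i ∷ I) (false ∷ A) I∩D≡⊥ A⊆D max∈A =
  colex-step (i ∨ false) (i ∨ false) (colex-later D I A (∷-injectiveʳ I∩D≡⊥) (drop-∷-⊆ A⊆D) max∈A)
colex-later (false ∷ D) I           (true ∷ A)  _ A⊆D _ = inside∷⊈outside∷ A⊆D
colex-later (true ∷ D)  (true ∷ I)  A           ()
colex-later (true ∷ D)  (false ∷ I) (a ∷ A) I∩D≡⊥ A⊆D max∈A with ∣ D ∣ in ∣D∣≡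
colex-later (true ∷ D)  (false ∷ I) (false ∷ A) I∩D≡⊥ A⊆D () | zero
colex-later (true ∷ D)  (false ∷ I) (true ∷ A)  I∩D≡⊥ A⊆D _  | zero
  rewrite I∪A≡I∪[D─A] D I A ∣D∣≡ (drop-∷-⊆ A⊆D) = n<1+n _
colex-later (true ∷ D)  (false ∷ I) (false ∷ A) I∩D≡⊥ A⊆D max∈A | suc _ =
  colex-step true false (colex-later D I A (∷-injectiveʳ I∩D≡⊥) (drop-∷-⊆ A⊆D) max∈A)
colex-later (true ∷ D)  (false ∷ I) (true ∷ A)  I∩D≡⊥ A⊆D max∈A | suc _ =
  colex-step false true (colex-later D I A (∷-injectiveʳ I∩D≡⊥) (drop-∷-⊆ A⊆D) max∈A)

count⊆-maxInside : ∀ {n k} (D : Subset n) → ∣ D ∣ ≡ suc k → count⊆ D (maxInside D) ≡ 2 ^ k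
count⊆-maxInside (false ∷ D) ∣D∣≡ = count⊆-maxInside D ∣D∣≡
count⊆-maxInside (true ∷ D)  ∣D∣≡ with ∣ D ∣ in ∣D∣≡′ | ∣D∣≡
... | zero  | refl = cong₂ _+_ (count⊆-false D) (trans (count⊆-true D) (cong (2 ^_) ∣D∣≡′))
... | suc j | refl = cong₂ _+_ (count⊆-maxInside D ∣D∣≡′)
                               (trans (count⊆-maxInside D ∣D∣≡′) (sym (+-identityʳ (2 ^ j))))

count⊆-minOutside∧maxInside : ∀ {n k} (D : Subset n) → ∣ D ∣ ≡ suc (suc k) →
                             count⊆ D (λ A → minOutside D A ∧ maxInside D A) ≡ 2 ^ k
count⊆-minOutside∧maxInside (false ∷ D) ∣D∣≡ = count⊆-minOutside∧maxInside D ∣D∣≡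
count⊆-minOutside∧maxInside (true ∷ D)  ∣D∣≡ with ∣ D ∣ in ∣D∣≡′ | ∣D∣≡
... | suc j | refl = trans (cong₂ _+_ (count⊆-maxInside D ∣D∣≡′) (count⊆-false D)) (+-identityʳ _)

maxDiscordant≤countCDisc-lex-colex : ∀ {n} (D I : Subset n) → I ∩ D ≡ ⊥ →
                                     maxDiscordant ∣ D ∣ ≤ countCDisc lex colex D I
maxDiscordant≤countCDisc-lex-colex D I I∩D≡⊥ with ∣ D ∣ in ∣D∣≡
... | zero        = z≤n
... | suc zero    = z≤n
... | suc (suc k) = begin
  2 ^ k                                                        ≡⟨ sym (count⊆-minOutside∧maxInside D ∣D∣≡) ⟩
  count⊆ D (λ A → minOutside D A ∧ maxInside D A)              ≤⟨ count⊆-mono D discordant ⟩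
  count⊆ D (λ A → discordantᵇ lex colex (I ∪ A) (I ∪ (D ─ A))) ≡⟨ sym (countCDisc≡count⊆ lex colex D I I∩D≡⊥) ⟩
  countCDisc lex colex D I                                     ∎
  where
  open ≤-Reasoning
  discordant : ∀ A → A ⊆ D → T (minOutside D A ∧ maxInside D A) →
               T (discordantᵇ lex colex (I ∪ A) (I ∪ (D ─ A)))
  discordant A A⊆D min∉A∧max∈A with Equivalence.to T-∧ min∉A∧max∈A
  ... | min∉A , max∈A = Equivalence.from T-∧
    (<⇒<ᵇ (lex-earlier D I A I∩D≡⊥ A⊆D min∉A) , <⇒<ᵇ (colex-later D I A I∩D≡⊥ A⊆D max∈A))

countCDisc-lex-colex : ∀ {n} (D I : Subset n) → I ∩ D ≡ ⊥ → countCDisc lex colex D I ≡ maxDiscordant ∣ D ∣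
countCDisc-lex-colex D I I∩D≡⊥ =
  ≤-antisym (countCDisc≤maxDiscordant lex colex D I I∩D≡⊥) (maxDiscordant≤countCDisc-lex-colex D I I∩D≡⊥)

countCDisc≤lex-colex : ∀ {n} (L M : LinExt n) (D I : Subset n) → countCDisc L M D I ≤ countCDisc lex colex D I
countCDisc≤lex-colex L M D I with (I ∩ D) ≟ₛ ⊥
... | yes I∩D≡⊥ = ≤-trans (countCDisc≤maxDiscordant L M D I I∩D≡⊥) (maxDiscordant≤countCDisc-lex-colex D I I∩D≡⊥)
... | no  I∩D≢⊥ = subst (_≤ _) (sym (countCDisc-overlapping L M D I I∩D≢⊥)) z≤n

-- A diametral pair is at least as far apart as (lex , colex), which is class by class the farthest.
diametral⇒countCDisc≡lex-colex : ∀ {n} (L M : LinExt n) → Diametral L M →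
                                 ∀ D I → countCDisc L M D I ≡ countCDisc lex colex D I
diametral⇒countCDisc≡lex-colex {n} L M diametral D I =
  ∑-≤-≡ (allPairs n) (λ k → countCDisc≤lex-colex L M (proj₁ k) (proj₂ k))
        (subst₂ _≤_ (distance≡∑countCDisc {n} lex colex) (distance≡∑countCDisc L M) (diametral lex colex))
        (∈-cartesianProduct⁺ (∈-allSubsets D) (∈-allSubsets I))

maxDiscordant-≥2 : ∀ {d} → 2 ≤ d → maxDiscordant d ≡ 2 ^ (d ∸ 2)
maxDiscordant-≥2 (s≤s (s≤s _)) = refl

fact1 : (n : ℕ) → 1 ≤ n → (L L̄ : LinExt n) → Diametral L L̄ →
        (D I : Subset n) → 2 ≤ ∣ D ∣ → (I ∩ D) ≡ ⊥ →
        countCDisc L L̄ D I ≡ 2 ^ (∣ D ∣ ∸ 2)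
fact1 n _ L L̄ diametral D I 2≤∣D∣ I∩D≡⊥ = begin
  countCDisc L L̄ D I        ≡⟨ diametral⇒countCDisc≡lex-colex L L̄ diametral D I ⟩
  countCDisc lex colex D I  ≡⟨ countCDisc-lex-colex D I I∩D≡⊥ ⟩
  maxDiscordant ∣ D ∣       ≡⟨ maxDiscordant-≥2 2≤∣D∣ ⟩
  2 ^ (∣ D ∣ ∸ 2)           ∎
  where open ≡-Reasoning
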